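{- Let $\Gamma$ be a set of $\mathcal{L}$-sentences none of which contains an occurrence of $\rightarrow$, and let $\phi,\psi$ be $\mathcal{L}$-sentences. If $\Gamma\models\phi\rightarrow\psi$ then $\Gamma\cup\{\phi\}\models\psi$.
   Context: Let $\mathcal{L}$ be a first-order language (constant, function and relation symbols) whose formulas are built from atomic formulas $R^n(t_1,\dots,t_n)$, $\top$ and $\bot$ using exactly the primitive operators $\wedge,\vee,\rightarrow,\forall,\exists$. An $\mathcal{L}$-model is a tuple $\mathfrak{M}=\langle W,\prec,M,|\cdot|\rangle$ where $W$ is a nonempty set of worlds, $\prec$ is a transitive (not necessarily reflexive) binary relation on $W$, $M$ is a nonempty set (the single domain shared by all worlds), $|c|\in M$ for each constant symbol, $|f^n|:M^n\to M$ for each function symbol, and $|R^n|:W\to\mathcal{P}(M^n)$ for each relation symbol, subject to: $w\prec u$ implies $|R^n|(w)\subseteq|R^n|(u)$. Terms are evaluated in $M$ as usual. Forcing: $w\Vdash\top$; $w\not\Vdash\bot$; $w\Vdash R^n(t_1,\dots,t_n)(\bar a)$ iff $\langle|t_1|(\bar a),\dots,|t_n|(\bar a)\rangle\in|R^n|(w)$; $\wedge,\vee$ are evaluated pointwise at $w$; $w\Vdash(\phi\rightarrow\psi)(\bar a)$ iff for all $u$ with $w\prec u$, $u\Vdash\phi(\bar a)$ implies $u\Vdash\psi(\bar a)$; $w\Vdash\exists v\phi(\bar a)$ iff $w\Vdash\phi(\bar a,b)$ for some $b\in M$; $w\Vdash\forall v\phi(\bar a)$ iff $w\Vdash\phi(\bar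 a,b)$ for all $b\in M$. For sentences, $\Gamma\models\phi$ means: for every $\mathcal{L}$-model and every world $w$, if $w$ forces every member of $\Gamma$ then $w\Vdash\phi$. -}

module Defs where

open import Data.Nat using (ℕ; zero; suc)
open import Data.Fin using (Fin; zero; suc)
open import Data.Vec using (Vec; []; _∷_)
open import Data.Product using (Σ; _×_)
open import Data.Sum using (_⊎_)
open import Data.Unit using (⊤)
open import Data.Empty using (⊥)
open import Relation.Binary.PropositionalEquality using (_≡_)

record Language : Set₁ where
  field
    Const : Set
    Func  : Set
    funcArity : Func → ℕ
    Rel   : Set
    relArity : Rel → ℕ
open Language public

module _ (L : Language) where

  data Term (n : ℕ) : Set where
    var   : Fin n → Term n
    const : Const L → Term n
    func  : (f : Func L) → Vec (Term n) (funcArity L f) → Term n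

  data Formula (n : ℕ) : Set where
    rel   : (R : Rel L) → Vec (Term n) (relArity L R) → Formula n
    tt    : Formula n
    ff    : Formula n
    _and_ : Formula n → Formula n → Formula n
    _or_  : Formula n → Formula n → Formula n
    _imp_ : Formula n → Formula n → Formula n
    all   : Formula (suc n) → Formula n
    ex    : Formula (suc n) → Formula n

  Sentence : Set
  Sentence = Formula zero

  NoImp : ∀ {n} → Formula n → Set
  NoImp (rel R ts) = ⊤
  NoImp tt = ⊤
  NoImp ff = ⊤
  NoImp (φ and ψ) = NoImp φ × NoImp ψ
  NoImp (φ or ψ) = NoImp φ × NoImp ψ
  NoImp (φ imp ψ) = ⊥
  NoImp (all φ) = NoImp φ
  NoImp (ex φ) = NoImp φ

  -- L-models: worlds W with a transitive (not necessarily reflexive) relation ≺,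
  -- a single nonempty domain M, and monotone interpretations of relations.
  record Model : Set₁ where
    field
      W        : Set
      _≺_      : W → W → Set
      M        : Set
      W-nonempty : W
      M-nonempty : M
      ≺-trans  : ∀ {w u v} → w ≺ u → u ≺ v → w ≺ v
      constI   : Const L → M
      funcI    : (f : Func L) → Vec M (funcArity L f) → M
      relI     : (R : Rel L) → W → Vec M (relArity L R) → Set
      relI-mono : ∀ (R : Rel L) {w u} → w ≺ u →
                  ∀ (as : Vec M (relArity L R)) → relI R w as → relI R u as

  module _ (𝔐 : Model) where
    open Model 𝔐

    extend : ∀ {n} → (Fin n → M) → M → Fin (suc n) → M
    extend ρ b zero = b
    extend ρ b (suc i) = ρ i

    mutual
      evalTerm : ∀ {n} → (Fin n → M) → Term n → M
      evalTerm ρ (var i) = ρ i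
      evalTerm ρ (const c) = constI c
      evalTerm ρ (func f ts) = funcI f (evalTerms ρ ts)

      evalTerms : ∀ {n k} → (Fin n → M) → Vec (Term n) k → Vec M k
      evalTerms ρ [] = []
      evalTerms ρ (t ∷ ts) = evalTerm ρ t ∷ evalTerms ρ ts

    forces : ∀ {n} → W → (Fin n → M) → Formula n → Set
    forces w ρ (rel R ts) = relI R w (evalTerms ρ ts)
    forces w ρ tt = ⊤
    forces w ρ ff = ⊥
    forces w ρ (φ and ψ) = forces w ρ φ × forces w ρ ψ
    forces w ρ (φ or ψ) = forces w ρ φ ⊎ forces w ρ ψ
    forces w ρ (φ imp ψ) = ∀ u → w ≺ u → forces u ρ φ → forces u ρ ψ
    forces w ρ (all φ) = ∀ (b : M) → forces w (extend ρ b) φ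
    forces w ρ (ex φ) = Σ M (λ b → forces w (extend ρ b) φ)

    emptyEnv : Fin zero → M
    emptyEnv ()

    forcesS : W → Sentence → Set
    forcesS w φ = forces w emptyEnv φ

  _⊨_ : (Sentence → Set) → Sentence → Set₁
  Γ ⊨ φ = ∀ (𝔐 : Model) (w : Model.W 𝔐) →
          (∀ γ → Γ γ → forcesS 𝔐 w γ) → forcesS 𝔐 w φ

  insert : (Sentence → Set) → Sentence → (Sentence → Set)
  insert Γ φ χ = Γ χ ⊎ χ ≡ φ

module Submission where

-- Suppose w₀ forces every sentence of Γ and φ.  The world w₀ need
-- not be ≺-related to itself, so the hypothesis Γ ⊨ φ → ψ cannot be applied at
-- w₀ directly.  Instead we add a fresh root world below w₀: a copy of w₀ whose
-- successors are w₀ itself and all successors of w₀, and whose atoms are those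
-- of w₀.  In this extended model
--   * every old world forces exactly what it forced before, since its cone of
--     successors is unchanged (forcing-preserved / forcing-reflected);
--   * the root forces every implication-free formula that w₀ forces, because
--     without → forcing never looks at successors (root-forces-NoImp).
-- Hence the root forces Γ, so it forces φ → ψ; since the root sees w₀ and w₀
-- forces φ, the copy of w₀ forces ψ, and therefore so does w₀ itself.

open import Defs
open import Data.Nat using (ℕ)
open import Data.Fin using (Fin; zero; suc)
open import Data.Vec using (Vec; []; _∷_)
open import Data.Product using (_,_)
open import Data.Sum using (_⊎_; inj₁; inj₂)
open import Data.Empty using (⊥)
open import Data.Maybe using (Maybe; just; nothing)
open import Relation.Binary.PropositionalEquality
  using (_≡_; refl; sym; cong; cong₂; subst)

module RootExtension (L : Language) (𝔐 : Model L) (w₀ : Model.W 𝔐) where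
  open Model 𝔐

  pattern root = nothing
  pattern old u = just u

  _≺⁺_ : Maybe W → Maybe W → Set
  _     ≺⁺ root  = ⊥
  root  ≺⁺ old v = (w₀ ≡ v) ⊎ (w₀ ≺ v)
  old u ≺⁺ old v = u ≺ v

  ≺⁺-trans : ∀ {a b c} → a ≺⁺ b → b ≺⁺ c → a ≺⁺ c
  ≺⁺-trans {c = root} _ ()
  ≺⁺-trans {b = root} {c = old _} () _
  ≺⁺-trans {old _} {old _} {old _} a≺b b≺c = ≺-trans a≺b b≺c
  ≺⁺-trans {root} {old _} {old _} (inj₁ refl) w₀≺c = inj₂ w₀≺c
  ≺⁺-trans {root} {old _} {old _} (inj₂ w₀≺b) b≺c = inj₂ (≺-trans w₀≺b b≺c)

  relI⁺ : (R : Rel L) → Maybe W → Vec M (relArity L R) → Set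
  relI⁺ R root    = relI R w₀
  relI⁺ R (old u) = relI R u

  relI⁺-mono : ∀ (R : Rel L) {a b} → a ≺⁺ b →
               ∀ as → relI⁺ R a as → relI⁺ R b as
  relI⁺-mono R {b = root} ()
  relI⁺-mono R {old _} {old _} a≺b as x = relI-mono R a≺b as x
  relI⁺-mono R {root} {old _} (inj₁ refl) as x = x
  relI⁺-mono R {root} {old _} (inj₂ w₀≺b) as x = relI-mono R w₀≺b as x

  𝔐⁺ : Model L
  𝔐⁺ = record
    { W = Maybe W ; _≺_ = _≺⁺_ ; M = M
    ; W-nonempty = root ; M-nonempty = M-nonempty
    ; ≺-trans = λ {a} {b} {c} → ≺⁺-trans {a} {b} {c}
    ; constI = constI ; funcI = funcI
    ; relI = relI⁺ ; relI-mono = relI⁺-mono }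

  root-sees-w₀ : root ≺⁺ old w₀
  root-sees-w₀ = inj₁ refl

  -- Both models share the domain M, so assignments are the same objects;
  -- _≈_ is pointwise agreement, needed because extend is computed per model.
  Env : ℕ → Set
  Env n = Fin n → M

  _≈_ : ∀ {n} → Env n → Env n → Set
  ρ ≈ σ = ∀ i → ρ i ≡ σ i

  extend-≈ : ∀ {n} {ρ σ : Env n} → ρ ≈ σ →
             ∀ b → extend L 𝔐⁺ ρ b ≈ extend L 𝔐 σ b
  extend-≈ ρ≈σ b zero    = refl
  extend-≈ ρ≈σ b (suc i) = ρ≈σ i

  empty-≈ : emptyEnv L 𝔐⁺ ≈ emptyEnv L 𝔐
  empty-≈ ()

  mutual
    evalTerm-≈ : ∀ {n} {ρ σ : Env n} → ρ ≈ σ → (t : Term L n) →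
                 evalTerm L 𝔐⁺ ρ t ≡ evalTerm L 𝔐 σ t
    evalTerm-≈ ρ≈σ (var i)     = ρ≈σ i
    evalTerm-≈ ρ≈σ (const c)   = refl
    evalTerm-≈ ρ≈σ (func f ts) = cong (funcI f) (evalTerms-≈ ρ≈σ ts)

    evalTerms-≈ : ∀ {n k} {ρ σ : Env n} → ρ ≈ σ → (ts : Vec (Term L n) k) →
                  evalTerms L 𝔐⁺ ρ ts ≡ evalTerms L 𝔐 σ ts
    evalTerms-≈ ρ≈σ []       = refl
    evalTerms-≈ ρ≈σ (t ∷ ts) = cong₂ _∷_ (evalTerm-≈ ρ≈σ t) (evalTerms-≈ ρ≈σ ts)

  -- An old world forces in 𝔐⁺ exactly what it forces in 𝔐: its successors
  -- are the same old worlds (the root is never a successor).  The two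
  -- directions are proved simultaneously because → swaps them.
  mutual
    forcing-reflected : ∀ {n} u {ρ σ : Env n} → ρ ≈ σ → (χ : Formula L n) →
                        forces L 𝔐⁺ (old u) ρ χ → forces L 𝔐 u σ χ
    forcing-reflected u ρ≈σ (rel R ts) x = subst (relI R u) (evalTerms-≈ ρ≈σ ts) x
    forcing-reflected u ρ≈σ tt x = x
    forcing-reflected u ρ≈σ ff x = x
    forcing-reflected u ρ≈σ (α and β) (x , y) =
      forcing-reflected u ρ≈σ α x , forcing-reflected u ρ≈σ β y
    forcing-reflected u ρ≈σ (α or β) (inj₁ x) = inj₁ (forcing-reflected u ρ≈σ α x)
    forcing-reflected u ρ≈σ (α or β) (inj₂ y) = inj₂ (forcing-reflected u ρ≈σ β y)
    forcing-reflected u ρ≈σ (α imp β) f v u≺v x =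
      forcing-reflected v ρ≈σ β (f (old v) u≺v (forcing-preserved v ρ≈σ α x))
    forcing-reflected u ρ≈σ (all α) f b = forcing-reflected u (extend-≈ ρ≈σ b) α (f b)
    forcing-reflected u ρ≈σ (ex α) (b , x) = b , forcing-reflected u (extend-≈ ρ≈σ b) α x

    forcing-preserved : ∀ {n} u {ρ σ : Env n} → ρ ≈ σ → (χ : Formula L n) →
                        forces L 𝔐 u σ χ → forces L 𝔐⁺ (old u) ρ χ
    forcing-preserved u ρ≈σ (rel R ts) x = subst (relI R u) (sym (evalTerms-≈ ρ≈σ ts)) x
    forcing-preserved u ρ≈σ tt x = x
    forcing-preserved u ρ≈σ ff x = x
    forcing-preserved u ρ≈σ (α and β) (x , y) =
      forcing-preserved u ρ≈σ α x , forcing-preserved u ρ≈σ β y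
    forcing-preserved u ρ≈σ (α or β) (inj₁ x) = inj₁ (forcing-preserved u ρ≈σ α x)
    forcing-preserved u ρ≈σ (α or β) (inj₂ y) = inj₂ (forcing-preserved u ρ≈σ β y)
    forcing-preserved u ρ≈σ (α imp β) f root ()
    forcing-preserved u ρ≈σ (α imp β) f (old v) u≺v x =
      forcing-preserved v ρ≈σ β (f v u≺v (forcing-reflected v ρ≈σ α x))
    forcing-preserved u ρ≈σ (all α) f b = forcing-preserved u (extend-≈ ρ≈σ b) α (f b)
    forcing-preserved u ρ≈σ (ex α) (b , x) = b , forcing-preserved u (extend-≈ ρ≈σ b) α x

  -- Forcing an implication-free formula depends only on the atoms at the
  -- current world, and the root has the atoms of w₀.
  root-forces-NoImp : ∀ {n} {ρ σ : Env n} → ρ ≈ σ → (χ : Formula L n) →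
                      NoImp L χ → forces L 𝔐 w₀ σ χ → forces L 𝔐⁺ root ρ χ
  root-forces-NoImp ρ≈σ (rel R ts) _ x = subst (relI R w₀) (sym (evalTerms-≈ ρ≈σ ts)) x
  root-forces-NoImp ρ≈σ tt _ x = x
  root-forces-NoImp ρ≈σ ff _ x = x
  root-forces-NoImp ρ≈σ (α and β) (nα , nβ) (x , y) =
    root-forces-NoImp ρ≈σ α nα x , root-forces-NoImp ρ≈σ β nβ y
  root-forces-NoImp ρ≈σ (α or β) (nα , _) (inj₁ x) = inj₁ (root-forces-NoImp ρ≈σ α nα x)
  root-forces-NoImp ρ≈σ (α or β) (_ , nβ) (inj₂ y) = inj₂ (root-forces-NoImp ρ≈σ β nβ y)
  root-forces-NoImp ρ≈σ (α imp β) ()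
  root-forces-NoImp ρ≈σ (all α) nα f b = root-forces-NoImp (extend-≈ ρ≈σ b) α nα (f b)
  root-forces-NoImp ρ≈σ (ex α) nα (b , x) = b , root-forces-NoImp (extend-≈ ρ≈σ b) α nα x

mainTheorem6 : (L : Language) (Γ : Sentence L → Set) (φ ψ : Sentence L) →
               (∀ γ → Γ γ → NoImp L γ) →
               _⊨_ L Γ (_imp_ φ ψ) → _⊨_ L (insert L Γ φ) ψ
mainTheorem6 L Γ φ ψ Γ-NoImp Γ⊨φ→ψ 𝔐 w₀ w₀⊩Γ,φ =
  forcing-reflected w₀ empty-≈ ψ
    (root⊩φ→ψ (old w₀) root-sees-w₀ (forcing-preserved w₀ empty-≈ φ w₀⊩φ))
  where
    open RootExtension L 𝔐 w₀

    w₀⊩φ : forcesS L 𝔐 w₀ φ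
    w₀⊩φ = w₀⊩Γ,φ φ (inj₂ refl)

    root⊩Γ : ∀ γ → Γ γ → forcesS L 𝔐⁺ root γ
    root⊩Γ γ γ∈Γ = root-forces-NoImp empty-≈ γ (Γ-NoImp γ γ∈Γ) (w₀⊩Γ,φ γ (inj₁ γ∈Γ))

    root⊩φ→ψ : forcesS L 𝔐⁺ root (φ imp ψ)
    root⊩φ→ψ = Γ⊨φ→ψ 𝔐⁺ root root⊩Γ
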